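{- Let $\alpha=(1+\sqrt{5})/2$ and $\beta=(1-\sqrt{5})/2$. For all nonnegative integers $n,N$ and every integer $j\geq 1$, $$\sum_{s=0}^N\Bigl(\bigl(\alpha^j+\sqrt{5}F_js\bigr)^n-\bigl(\beta^j+\sqrt{5}F_js\bigr)^n\Bigr) = \bigl(\sqrt{5}F_jN+\alpha^j\bigr)^n-\beta^{jn}$$ and $$\sum_{s=0}^N\Bigl(\bigl(\beta^j-\sqrt{5}F_js\bigr)^n-\bigl(\alpha^j-\sqrt{5}F_js\bigr)^n\Bigr) = \bigl(-\sqrt{5}F_jN+\beta^j\bigr)^n-\alpha^{jn}.$$
   Context: $F_n$ denotes the Fibonacci numbers: $F_0=0$, $F_1=1$, $F_n=F_{n-1}+F_{n-2}$. Convention $0^0=1$. -}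

module Defs where

open import Data.Nat as ℕ using (ℕ; zero; suc)
open import Data.Integer as ℤ using (ℤ; +_; -[1+_])

fib : ℕ → ℕ
fib zero = 0
fib (suc zero) = 1
fib (suc (suc n)) = fib (suc n) ℕ.+ fib n

-- The ring ℤ[φ] ⊂ ℝ, φ = α = (1+√5)/2, φ² = φ + 1.
-- An element a + bφ is represented by the pair (a , b); this representation
-- is unique (φ irrational), so propositional equality is equality of reals.
record ℤφ : Set where
  constructor mk
  field
    re : ℤ
    im : ℤ
open ℤφ public

infixl 6 _⊕_ _⊖_
infixl 7 _⊗_
infixr 8 _^φ_

_⊕_ : ℤφ → ℤφ → ℤφ
mk a b ⊕ mk c d = mk (a ℤ.+ c) (b ℤ.+ d)

⊝_ : ℤφ → ℤφ
⊝ mk a b = mk (ℤ.- a) (ℤ.- b)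

_⊖_ : ℤφ → ℤφ → ℤφ
x ⊖ y = x ⊕ (⊝ y)

-- (a + bφ)(c + dφ) = (ac + bd) + (ad + bc + bd)φ
_⊗_ : ℤφ → ℤφ → ℤφ
mk a b ⊗ mk c d = mk (a ℤ.* c ℤ.+ b ℤ.* d) (a ℤ.* d ℤ.+ b ℤ.* c ℤ.+ b ℤ.* d)

0φ 1φ : ℤφ
0φ = mk (+ 0) (+ 0)
1φ = mk (+ 1) (+ 0)

_^φ_ : ℤφ → ℕ → ℤφ
x ^φ zero = 1φ
x ^φ suc n = x ⊗ (x ^φ n)

ι : ℕ → ℤφ
ι n = mk (+ n) (+ 0)

-- α = (1+√5)/2 = φ, β = (1-√5)/2 = 1 - φ, √5 = 2φ - 1
α β √5 : ℤφ
α  = mk (+ 0) (+ 1)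
β  = mk (+ 1) (ℤ.- (+ 1))
√5 = mk (ℤ.- (+ 1)) (+ 2)

Σ[0…_] : ℕ → (ℕ → ℤφ) → ℤφ
Σ[0… zero ] f = f 0
Σ[0… suc N ] f = Σ[0… N ] f ⊕ f (suc N)

-- Binet: with d = √5 F_j we have α^j = β^j + d, because φ^k = F_{k-1} + F_k φ and the
-- conjugation φ ↦ 1 - φ (a ring automorphism of ℤ[φ] sending α to β) changes a + bφ by b√5.
-- Hence the s-th summand of the first sum is g(s+1) - g(s) with g(s) = (β^j + d s)^n, and that
-- of the second is h(s+1) - h(s) with h(s) = (α^j - d s)^n, so both sums telescope.
module Submission where

open import Defs
open import Relation.Binary.PropositionalEquality
open ≡-Reasoning
open import Algebra using (CommutativeRing)
open import Algebra.Structures {A = ℤφ} _≡_ using (IsCommutativeRing)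
open import Algebra.Definitions {A = ℤφ} _≡_
open import Algebra.Consequences.Propositional
  using (comm∧idˡ⇒id; comm∧invˡ⇒inv; comm∧distrʳ⇒distrˡ)
open import Data.Nat as ℕ using (ℕ; zero; suc; _*_; _≥_)
import Data.Nat.Properties as ℕ
open import Data.Integer as ℤ using (ℤ; +_; -_; _+_; 0ℤ; 1ℤ)
import Data.Integer.Properties as ℤ
open import Data.Integer.Tactic.RingSolver using (solve-∀)
open import Data.Maybe using (just; nothing)
open import Data.Product using (_×_; _,_)
open import Level using (0ℓ)
import Tactic.RingSolver as RingSolver
open import Tactic.RingSolver.Core.AlmostCommutativeRing
  using (AlmostCommutativeRing; fromCommutativeRing)

⊕-assoc : Associative _⊕_
⊕-assoc (mk a b) (mk c d) (mk e f) = cong₂ mk (ℤ.+-assoc a c e) (ℤ.+-assoc b d f)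

⊕-comm : Commutative _⊕_
⊕-comm (mk a b) (mk c d) = cong₂ mk (ℤ.+-comm a c) (ℤ.+-comm b d)

⊕-identityˡ : LeftIdentity 0φ _⊕_
⊕-identityˡ (mk a b) = cong₂ mk (ℤ.+-identityˡ a) (ℤ.+-identityˡ b)

⊝-inverseˡ : LeftInverse 0φ ⊝_ _⊕_
⊝-inverseˡ (mk a b) = cong₂ mk (ℤ.+-inverseˡ a) (ℤ.+-inverseˡ b)

⊗-assoc : Associative _⊗_
⊗-assoc (mk a b) (mk c d) (mk e f) = cong₂ mk (re-assoc a b c d e f) (im-assoc a b c d e f)
  where
  re-assoc : ∀ a b c d e f →
    (a ℤ.* c + b ℤ.* d) ℤ.* e + (a ℤ.* d + b ℤ.* c + b ℤ.* d) ℤ.* f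
      ≡ a ℤ.* (c ℤ.* e + d ℤ.* f) + b ℤ.* (c ℤ.* f + d ℤ.* e + d ℤ.* f)
  re-assoc = solve-∀
  im-assoc : ∀ a b c d e f →
    (a ℤ.* c + b ℤ.* d) ℤ.* f + (a ℤ.* d + b ℤ.* c + b ℤ.* d) ℤ.* e + (a ℤ.* d + b ℤ.* c + b ℤ.* d) ℤ.* f
      ≡ a ℤ.* (c ℤ.* f + d ℤ.* e + d ℤ.* f) + b ℤ.* (c ℤ.* e + d ℤ.* f) + b ℤ.* (c ℤ.* f + d ℤ.* e + d ℤ.* f)
  im-assoc = solve-∀

⊗-comm : Commutative _⊗_
⊗-comm (mk a b) (mk c d) = cong₂ mk (cong₂ _+_ (ℤ.*-comm a c) (ℤ.*-comm b d)) (im-comm a b c d)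
  where
  im-comm : ∀ a b c d → a ℤ.* d + b ℤ.* c + b ℤ.* d ≡ c ℤ.* b + d ℤ.* a + d ℤ.* b
  im-comm = solve-∀

⊗-identityˡ : LeftIdentity 1φ _⊗_
⊗-identityˡ (mk a b) = cong₂ mk (re-identity a b) (im-identity a b)
  where
  re-identity : ∀ a b → 1ℤ ℤ.* a + 0ℤ ℤ.* b ≡ a
  re-identity = solve-∀
  im-identity : ∀ a b → 1ℤ ℤ.* b + 0ℤ ℤ.* a + 0ℤ ℤ.* b ≡ b
  im-identity = solve-∀

⊗-distribʳ-⊕ : _⊗_ DistributesOverʳ _⊕_
⊗-distribʳ-⊕ (mk a b) (mk c d) (mk e f) =
  cong₂ mk (re-distrib a b c d e f) (im-distrib a b c d e f)
  where
  re-distrib : ∀ a b c d e f →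
    (c + e) ℤ.* a + (d + f) ℤ.* b ≡ (c ℤ.* a + d ℤ.* b) + (e ℤ.* a + f ℤ.* b)
  re-distrib = solve-∀
  im-distrib : ∀ a b c d e f →
    (c + e) ℤ.* b + (d + f) ℤ.* a + (d + f) ℤ.* b
      ≡ (c ℤ.* b + d ℤ.* a + d ℤ.* b) + (e ℤ.* b + f ℤ.* a + f ℤ.* b)
  im-distrib = solve-∀

ℤφ-isCommutativeRing : IsCommutativeRing _⊕_ _⊗_ ⊝_ 0φ 1φ
ℤφ-isCommutativeRing = record
  { isRing = record
    { +-isAbelianGroup = record
      { isGroup = record
        { isMonoid = record
          { isSemigroup = record
            { isMagma = record { isEquivalence = isEquivalence ; ∙-cong = cong₂ _⊕_ }
            ; assoc = ⊕-assoc
            }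
          ; identity = comm∧idˡ⇒id ⊕-comm ⊕-identityˡ
          }
        ; inverse = comm∧invˡ⇒inv ⊕-comm ⊝-inverseˡ
        ; ⁻¹-cong = cong ⊝_
        }
      ; comm = ⊕-comm
      }
    ; *-cong = cong₂ _⊗_
    ; *-assoc = ⊗-assoc
    ; *-identity = comm∧idˡ⇒id ⊗-comm ⊗-identityˡ
    ; distrib = comm∧distrʳ⇒distrˡ ⊗-comm ⊗-distribʳ-⊕ , ⊗-distribʳ-⊕
    }
  ; *-comm = ⊗-comm
  }

ℤφ-commutativeRing : CommutativeRing 0ℓ 0ℓ
ℤφ-commutativeRing = record { isCommutativeRing = ℤφ-isCommutativeRing }

-- The solver decides equality of normal forms syntactically, so it must be able to
-- recognise vanishing coefficients such as 1φ ⊕ ⊝ 1φ.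
ℤφ-ring : AlmostCommutativeRing 0ℓ 0ℓ
ℤφ-ring = fromCommutativeRing ℤφ-commutativeRing λ { (mk (+ 0) (+ 0)) → just refl ; _ → nothing }

ι-suc : ∀ n → ι (suc n) ≡ ι n ⊕ 1φ
ι-suc n = cong₂ mk (cong +_ (ℕ.+-comm 1 n)) refl

^φ-+ : ∀ x m n → x ^φ (m ℕ.+ n) ≡ x ^φ m ⊗ x ^φ n
^φ-+ x zero    n = sym (⊗-identityˡ _)
^φ-+ x (suc m) n = trans (cong (x ⊗_) (^φ-+ x m n)) (sym (⊗-assoc x _ _))

^φ-* : ∀ x m n → (x ^φ m) ^φ n ≡ x ^φ (m * n)
^φ-* x m zero    = cong (x ^φ_) (sym (ℕ.*-zeroʳ m))
^φ-* x m (suc n) = begin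
  x ^φ m ⊗ (x ^φ m) ^φ n ≡⟨ cong (x ^φ m ⊗_) (^φ-* x m n) ⟩
  x ^φ m ⊗ x ^φ (m * n)  ≡⟨ sym (^φ-+ x m (m * n)) ⟩
  x ^φ (m ℕ.+ m * n)     ≡⟨ cong (x ^φ_) (sym (ℕ.*-suc m n)) ⟩
  x ^φ (m * suc n)       ∎

conj : ℤφ → ℤφ
conj (mk a b) = mk (a + b) (- b)

conj-⊗ : ∀ x y → conj (x ⊗ y) ≡ conj x ⊗ conj y
conj-⊗ (mk a b) (mk c d) = cong₂ mk (re-conj a b c d) (im-conj a b c d)
  where
  re-conj : ∀ a b c d →
    (a ℤ.* c + b ℤ.* d) + (a ℤ.* d + b ℤ.* c + b ℤ.* d) ≡ (a + b) ℤ.* (c + d) + (- b) ℤ.* (- d)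
  re-conj = solve-∀
  im-conj : ∀ a b c d →
    - (a ℤ.* d + b ℤ.* c + b ℤ.* d) ≡ (a + b) ℤ.* (- d) + (- b) ℤ.* (c + d) + (- b) ℤ.* (- d)
  im-conj = solve-∀

conj-^φ : ∀ x n → conj (x ^φ n) ≡ conj x ^φ n
conj-^φ x zero    = refl
conj-^φ x (suc n) = trans (conj-⊗ x (x ^φ n)) (cong (conj x ⊗_) (conj-^φ x n))

≡conj⊕√5⊗im : ∀ z → z ≡ conj z ⊕ √5 ⊗ mk (im z) 0ℤ
≡conj⊕√5⊗im (mk a b) = cong₂ mk (re-split a b) (im-split a b)
  where
  re-split : ∀ a b → a ≡ (a + b) + ((- 1ℤ) ℤ.* b + (1ℤ + 1ℤ) ℤ.* 0ℤ)
  re-split = solve-∀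
  im-split : ∀ a b → b ≡ (- b) + ((- 1ℤ) ℤ.* 0ℤ + (1ℤ + 1ℤ) ℤ.* b + (1ℤ + 1ℤ) ℤ.* 0ℤ)
  im-split = solve-∀

α⊗mk : ∀ a b → α ⊗ mk a b ≡ mk b (b + a)
α⊗mk a b = cong₂ mk (re-shift a b) (im-shift a b)
  where
  re-shift : ∀ a b → 0ℤ ℤ.* a + 1ℤ ℤ.* b ≡ b
  re-shift = solve-∀
  im-shift : ∀ a b → 0ℤ ℤ.* b + 1ℤ ℤ.* a + 1ℤ ℤ.* b ≡ b + a
  im-shift = solve-∀

α^suc≡fib : ∀ k → α ^φ suc k ≡ mk (+ fib k) (+ fib (suc k))
α^suc≡fib zero    = refl
α^suc≡fib (suc k) = trans (cong (α ⊗_) (α^suc≡fib k)) (α⊗mk (+ fib k) (+ fib (suc k)))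

im-α^≡fib : ∀ n → im (α ^φ n) ≡ + fib n
im-α^≡fib zero    = refl
im-α^≡fib (suc k) = cong im (α^suc≡fib k)

α^≡β^⊕√5fib : ∀ n → α ^φ n ≡ β ^φ n ⊕ √5 ⊗ ι (fib n)
α^≡β^⊕√5fib n = begin
  α ^φ n
    ≡⟨ ≡conj⊕√5⊗im (α ^φ n) ⟩
  conj (α ^φ n) ⊕ √5 ⊗ mk (im (α ^φ n)) 0ℤ
    ≡⟨ cong₂ (λ u v → u ⊕ √5 ⊗ mk v 0ℤ) (conj-^φ α n) (im-α^≡fib n) ⟩
  β ^φ n ⊕ √5 ⊗ ι (fib n) ∎

Σ-telescope : ∀ N {f g : ℕ → ℤφ} → (∀ s → f s ≡ g (suc s)) →
              Σ[0… N ] (λ s → f s ⊖ g s) ≡ f N ⊖ g 0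
Σ-telescope zero    f≡g∘suc = refl
Σ-telescope (suc N) {f} {g} f≡g∘suc = begin
  Σ[0… N ] (λ s → f s ⊖ g s) ⊕ (f (suc N) ⊖ g (suc N))
    ≡⟨ cong₂ _⊕_ (Σ-telescope N f≡g∘suc) (cong (f (suc N) ⊖_) (sym (f≡g∘suc N))) ⟩
  (f N ⊖ g 0) ⊕ (f (suc N) ⊖ f N)
    ≡⟨ cancel (g 0) (f N) (f (suc N)) ⟩
  f (suc N) ⊖ g 0 ∎
  where
  cancel : ∀ x y z → (y ⊖ x) ⊕ (z ⊖ y) ≡ z ⊖ x
  cancel = RingSolver.solve-∀ ℤφ-ring

⊕-progression-suc : ∀ x d s → (x ⊕ d) ⊕ d ⊗ ι s ≡ x ⊕ d ⊗ ι (suc s)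
⊕-progression-suc x d s = trans (shift x d (ι s)) (cong (λ t → x ⊕ d ⊗ t) (sym (ι-suc s)))
  where
  shift : ∀ x d t → (x ⊕ d) ⊕ d ⊗ t ≡ x ⊕ d ⊗ (t ⊕ 1φ)
  shift = RingSolver.solve-∀ ℤφ-ring

⊖-progression-suc : ∀ x d s → x ⊖ d ⊗ ι s ≡ (x ⊕ d) ⊖ d ⊗ ι (suc s)
⊖-progression-suc x d s = trans (shift x d (ι s)) (cong (λ t → (x ⊕ d) ⊖ d ⊗ t) (sym (ι-suc s)))
  where
  shift : ∀ x d t → x ⊖ d ⊗ t ≡ (x ⊕ d) ⊖ d ⊗ (t ⊕ 1φ)
  shift = RingSolver.solve-∀ ℤφ-ring

Σ-⊕-progression : ∀ n N a b d → a ≡ b ⊕ d →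
  Σ[0… N ] (λ s → (a ⊕ d ⊗ ι s) ^φ n ⊖ (b ⊕ d ⊗ ι s) ^φ n) ≡ (a ⊕ d ⊗ ι N) ^φ n ⊖ b ^φ n
Σ-⊕-progression n N a b d a≡b⊕d = begin
  Σ[0… N ] (λ s → (a ⊕ d ⊗ ι s) ^φ n ⊖ (b ⊕ d ⊗ ι s) ^φ n)
    ≡⟨ Σ-telescope N (λ s → cong (_^φ n) (a⊕d⊗ι≡b⊕d⊗ιsuc s)) ⟩
  (a ⊕ d ⊗ ι N) ^φ n ⊖ (b ⊕ d ⊗ 0φ) ^φ n
    ≡⟨ cong (λ x → (a ⊕ d ⊗ ι N) ^φ n ⊖ x ^φ n) (x⊕d⊗0≡x b d) ⟩
  (a ⊕ d ⊗ ι N) ^φ n ⊖ b ^φ n ∎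
  where
  a⊕d⊗ι≡b⊕d⊗ιsuc : ∀ s → a ⊕ d ⊗ ι s ≡ b ⊕ d ⊗ ι (suc s)
  a⊕d⊗ι≡b⊕d⊗ιsuc s = trans (cong (_⊕ d ⊗ ι s) a≡b⊕d) (⊕-progression-suc b d s)
  x⊕d⊗0≡x : ∀ x d → x ⊕ d ⊗ 0φ ≡ x
  x⊕d⊗0≡x = RingSolver.solve-∀ ℤφ-ring

Σ-⊖-progression : ∀ n N a b d → a ≡ b ⊕ d →
  Σ[0… N ] (λ s → (b ⊖ d ⊗ ι s) ^φ n ⊖ (a ⊖ d ⊗ ι s) ^φ n) ≡ (b ⊖ d ⊗ ι N) ^φ n ⊖ a ^φ n
Σ-⊖-progression n N a b d a≡b⊕d = begin
  Σ[0… N ] (λ s → (b ⊖ d ⊗ ι s) ^φ n ⊖ (a ⊖ d ⊗ ι s) ^φ n)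
    ≡⟨ Σ-telescope N (λ s → cong (_^φ n) (b⊖d⊗ι≡a⊖d⊗ιsuc s)) ⟩
  (b ⊖ d ⊗ ι N) ^φ n ⊖ (a ⊖ d ⊗ 0φ) ^φ n
    ≡⟨ cong (λ x → (b ⊖ d ⊗ ι N) ^φ n ⊖ x ^φ n) (x⊖d⊗0≡x a d) ⟩
  (b ⊖ d ⊗ ι N) ^φ n ⊖ a ^φ n ∎
  where
  b⊖d⊗ι≡a⊖d⊗ιsuc : ∀ s → b ⊖ d ⊗ ι s ≡ a ⊖ d ⊗ ι (suc s)
  b⊖d⊗ι≡a⊖d⊗ιsuc s = trans (⊖-progression-suc b d s) (cong (_⊖ d ⊗ ι (suc s)) (sym a≡b⊕d))
  x⊖d⊗0≡x : ∀ x d → x ⊖ d ⊗ 0φ ≡ x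
  x⊖d⊗0≡x = RingSolver.solve-∀ ℤφ-ring

corollary17 : (n N j : ℕ) → j ≥ 1 →
    (Σ[0… N ] (λ s → ((α ^φ j) ⊕ √5 ⊗ ι (fib j) ⊗ ι s) ^φ n ⊖ ((β ^φ j) ⊕ √5 ⊗ ι (fib j) ⊗ ι s) ^φ n)
      ≡ (√5 ⊗ ι (fib j) ⊗ ι N ⊕ (α ^φ j)) ^φ n ⊖ β ^φ (j * n))
    × (Σ[0… N ] (λ s → ((β ^φ j) ⊖ √5 ⊗ ι (fib j) ⊗ ι s) ^φ n ⊖ ((α ^φ j) ⊖ √5 ⊗ ι (fib j) ⊗ ι s) ^φ n)
      ≡ ((⊝ (√5 ⊗ ι (fib j) ⊗ ι N)) ⊕ (β ^φ j)) ^φ n ⊖ α ^φ (j * n))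
corollary17 n N j _ =
  trans (Σ-⊕-progression n N (α ^φ j) (β ^φ j) d binet)
        (cong₂ (λ x y → x ^φ n ⊖ y) (⊕-comm (α ^φ j) (d ⊗ ι N)) (^φ-* β j n)) ,
  trans (Σ-⊖-progression n N (α ^φ j) (β ^φ j) d binet)
        (cong₂ (λ x y → x ^φ n ⊖ y) (⊕-comm (β ^φ j) (⊝ (d ⊗ ι N))) (^φ-* α j n))
  where
  d : ℤφ
  d = √5 ⊗ ι (fib j)
  binet : α ^φ j ≡ β ^φ j ⊕ d
  binet = α^≡β^⊕√5fib j
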